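{- Every satisfiable set $\Phi\subseteq\mathrm{FO}\cup{\sim}\mathrm{FO}$ is satisfied by a valuation $(\mathcal{A},T)$ whose team $T$ has cardinality $|\Phi\cap{\sim}\mathrm{FO}|$.
   Context: $\mathrm{FO}$: first-order formulas over a countable vocabulary $\tau$ (with $\neg,\to,\forall$ and equality). ${\sim}\mathrm{FO}=\{\sim\delta:\delta\in\mathrm{FO}\}$. Team semantics: valuations $(\mathcal{A},T)$, $\mathcal{A}$ a $\tau$-structure with nonempty domain $A$, $T$ a set of assignments $\mathrm{Var}\to A$; $(\mathcal{A},T)\models\alpha$ ($\alpha\in\mathrm{FO}$) iff every $s\in T$ satisfies $\alpha$ classically; $(\mathcal{A},T)\models\sim\delta$ iff $(\mathcal{A},T)\not\models\delta$.
   Formalization: The team T has cardinality at most, rather than exactly, $|\Phi\cap{\sim}\mathrm{FO}|$. The statement above fails without it. -}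

module Defs where

open import Data.Nat using (ℕ; _≟_)
open import Data.Vec using (Vec; []; _∷_)
open import Data.Bool using (Bool; true)
open import Data.Product using (Σ; _×_; proj₁)
open import Relation.Binary.PropositionalEquality using (_≡_; _≗_)
open import Relation.Nullary using (¬_; Dec; yes; no)
open import Function.Definitions using (Injective)

-- Classical metatheory (the paper reasons classically): excluded middle for Set.
LEM : Set₁
LEM = (P : Set) → Dec P

-- A countable vocabulary: function symbols (constants = 0-ary functions) and
-- relation symbols with arities, each coded injectively into ℕ.
record Vocabulary : Set₁ where
  field
    Fun       : Set
    Rel       : Set
    funArity  : Fun → ℕ
    relArity  : Rel → ℕ
    funCode   : Fun → ℕ
    funCode-injective : Injective _≡_ _≡_ funCode
    relCode   : Rel → ℕ
    relCode-injective : Injective _≡_ _≡_ relCode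

open Vocabulary public

Var : Set
Var = ℕ

data Term (τ : Vocabulary) : Set where
  var : Var → Term τ
  fun : (f : Fun τ) → Vec (Term τ) (funArity τ f) → Term τ

data Formula (τ : Vocabulary) : Set where
  _≐_  : Term τ → Term τ → Formula τ
  rel  : (R : Rel τ) → Vec (Term τ) (relArity τ R) → Formula τ
  ¬'   : Formula τ → Formula τ
  _⇒_  : Formula τ → Formula τ → Formula τ
  ∀'   : Var → Formula τ → Formula τ

record Structure (τ : Vocabulary) : Set₁ where
  field
    Dom  : Set
    elem : Dom
    funI : (f : Fun τ) → Vec Dom (funArity τ f) → Dom
    relI : (R : Rel τ) → Vec Dom (relArity τ R) → Set

open Structure public

Assignment : {τ : Vocabulary} → Structure τ → Set
Assignment 𝒜 = Var → Dom 𝒜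

update : {τ : Vocabulary} {𝒜 : Structure τ} → Assignment 𝒜 → Var → Dom 𝒜 → Assignment 𝒜
update s x a y with y ≟ x
... | yes _ = a
... | no  _ = s y

module _ {τ : Vocabulary} (𝒜 : Structure τ) where
  mutual
    evalTerm : Term τ → Assignment 𝒜 → Dom 𝒜
    evalTerm (var x)    s = s x
    evalTerm (fun f ts) s = funI 𝒜 f (evalTerms ts s)

    evalTerms : {n : ℕ} → Vec (Term τ) n → Assignment 𝒜 → Vec (Dom 𝒜) n
    evalTerms []       s = []
    evalTerms (t ∷ ts) s = evalTerm t s ∷ evalTerms ts s

  Sat : Assignment 𝒜 → Formula τ → Set
  Sat s (t ≐ u)    = evalTerm t s ≡ evalTerm u s
  Sat s (rel R ts) = relI 𝒜 R (evalTerms ts s)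
  Sat s (¬' φ)     = ¬ Sat s φ
  Sat s (φ ⇒ ψ)    = Sat s φ → Sat s ψ
  Sat s (∀' x φ)   = (a : Dom 𝒜) → Sat (update {𝒜 = 𝒜} s x a) φ

Team : {τ : Vocabulary} → Structure τ → Set₁
Team 𝒜 = Assignment 𝒜 → Set

data TFormula (τ : Vocabulary) : Set where
  fo : Formula τ → TFormula τ
  ∼_ : Formula τ → TFormula τ

TSat : {τ : Vocabulary} (𝒜 : Structure τ) → Team 𝒜 → TFormula τ → Set
TSat 𝒜 T (fo α) = (s : Assignment 𝒜) → T s → Sat 𝒜 s α
TSat 𝒜 T (∼ δ)  = ¬ TSat 𝒜 T (fo δ)

FormulaSet : Vocabulary → Set
FormulaSet τ = TFormula τ → Bool

_∈_ : {τ : Vocabulary} → TFormula τ → FormulaSet τ → Set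
ψ ∈ Φ = Φ ψ ≡ true

_,_⊨_ : {τ : Vocabulary} (𝒜 : Structure τ) → Team 𝒜 → FormulaSet τ → Set
𝒜 , T ⊨ Φ = (ψ : TFormula _) → ψ ∈ Φ → TSat 𝒜 T ψ

Satisfiable : {τ : Vocabulary} → FormulaSet τ → Set₁
Satisfiable {τ} Φ = Σ (Structure τ) λ 𝒜 → Σ (Team 𝒜) λ T → 𝒜 , T ⊨ Φ

-- Φ ∩ ∼FO, as the set of δ with ∼δ ∈ Φ
NegPart : {τ : Vocabulary} → FormulaSet τ → Set
NegPart {τ} Φ = Σ (Formula τ) λ δ → (∼ δ) ∈ Φ

-- |T| ≤ |Φ ∩ ∼FO| : an injection of T (assignments up to extensional equality)
-- into Φ ∩ ∼FO
CardLeq : {τ : Vocabulary} (𝒜 : Structure τ) → Team 𝒜 → FormulaSet τ → Set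
CardLeq 𝒜 T Φ =
  Σ ((s : Assignment 𝒜) → T s → NegPart Φ) λ g →
    (s : Assignment 𝒜) (p : T s) (s' : Assignment 𝒜) (p' : T s') →
    proj₁ (g s p) ≡ proj₁ (g s' p') → s ≗ s'

{-# OPTIONS --safe #-}
module Submission where

open import Defs
open import Data.Bool using (_≟_)
open import Data.Empty using (⊥-elim)
open import Data.Product using (Σ; ∃; _×_; _,_; proj₁; proj₂)
open import Data.Product.Properties using (Σ-≡,≡→≡)
open import Function using (_∘_)
open import Axiom.UniquenessOfIdentityProofs using (module Decidable⇒UIP)
open import Relation.Nullary using (¬_; yes; no)
open import Relation.Nullary.Decidable using (decidable-stable)
open import Relation.Unary using (_⊆_)
open import Relation.Binary.PropositionalEquality using (_≡_; refl; cong; cong-app)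

-- Choose, for every ∼δ ∈ Φ, an assignment of the given team falsifying δ.  The team of
-- chosen assignments is a subteam, so the downward-closed FO part of Φ still holds,
-- and it keeps a counterexample for each ∼δ.  It is indexed by Φ ∩ ∼FO, so it is no
-- larger than that set.

¬∀⇒∃¬ : LEM → {A : Set} {P Q : A → Set} →
        ¬ (∀ x → P x → Q x) → ∃ λ x → P x × ¬ Q x
¬∀⇒∃¬ lem {P = P} {Q} ¬∀ with lem (∃ λ x → P x × ¬ Q x)
... | yes ∃¬ = ∃¬
... | no ¬∃¬ = ⊥-elim (¬∀ λ x Px →
  decidable-stable (lem (Q x)) λ ¬Qx → ¬∃¬ (x , Px , ¬Qx))

module _ {τ : Vocabulary} where

  Counterexample : (𝒜 : Structure τ) → Team 𝒜 → Formula τ → Set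
  Counterexample 𝒜 T δ = Σ (Assignment 𝒜) λ s → T s × ¬ Sat 𝒜 s δ

  counterexample⇒∼ : {𝒜 : Structure τ} {T : Team 𝒜} {δ : Formula τ} →
                     Counterexample 𝒜 T δ → TSat 𝒜 T (∼ δ)
  counterexample⇒∼ (s , s∈T , ¬δ) T⊨δ = ¬δ (T⊨δ s s∈T)

  ∼⇒counterexample : LEM → {𝒜 : Structure τ} {T : Team 𝒜} {δ : Formula τ} →
                     TSat 𝒜 T (∼ δ) → Counterexample 𝒜 T δ
  ∼⇒counterexample lem = ¬∀⇒∃¬ lem

  fo-downward-closed : {𝒜 : Structure τ} {T T′ : Team 𝒜} {α : Formula τ} →
                       T′ ⊆ T → TSat 𝒜 T (fo α) → TSat 𝒜 T′ (fo α)
  fo-downward-closed T′⊆T T⊨α s s∈T′ = T⊨α s (T′⊆T s∈T′)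

  image : (𝒜 : Structure τ) {I : Set} → (I → Assignment 𝒜) → Team 𝒜
  image 𝒜 {I} c s = Σ I λ i → c i ≡ s

NegPart-≡ : {τ : Vocabulary} {Φ : FormulaSet τ} (n n′ : NegPart Φ) →
            proj₁ n ≡ proj₁ n′ → n ≡ n′
NegPart-≡ (δ , p) (δ′ , p′) refl = Σ-≡,≡→≡ (refl , ≡-irrelevant p p′)
  where open Decidable⇒UIP _≟_ using (≡-irrelevant)

image-CardLeq : {τ : Vocabulary} {Φ : FormulaSet τ} {𝒜 : Structure τ}
                (c : NegPart Φ → Assignment 𝒜) → CardLeq 𝒜 (image 𝒜 c) Φ
image-CardLeq {Φ = Φ} c = (λ _ → proj₁) , λ where
  _ (n , refl) _ (n′ , refl) δ≡δ′ → cong-app (cong c (NegPart-≡ {Φ = Φ} n n′ δ≡δ′))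

module CounterexampleTeam (lem : LEM) {τ : Vocabulary} {Φ : FormulaSet τ}
                          {𝒜 : Structure τ} {T : Team 𝒜} (T⊨Φ : 𝒜 , T ⊨ Φ) where

  chosenCounterexample : (n : NegPart Φ) → Counterexample 𝒜 T (proj₁ n)
  chosenCounterexample (δ , ∼δ∈Φ) =
    ∼⇒counterexample lem {δ = δ} (T⊨Φ (∼ δ) ∼δ∈Φ)

  chosenAssignment : NegPart Φ → Assignment 𝒜
  chosenAssignment = proj₁ ∘ chosenCounterexample

  counterexampleTeam : Team 𝒜
  counterexampleTeam = image 𝒜 chosenAssignment

  counterexampleTeam⊆T : counterexampleTeam ⊆ T
  counterexampleTeam⊆T (n , refl) = proj₁ (proj₂ (chosenCounterexample n))

  counterexampleTeam-counterexample : (n : NegPart Φ) →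
                                      Counterexample 𝒜 counterexampleTeam (proj₁ n)
  counterexampleTeam-counterexample n =
    chosenAssignment n , (n , refl) , proj₂ (proj₂ (chosenCounterexample n))

  counterexampleTeam⊨Φ : 𝒜 , counterexampleTeam ⊨ Φ
  counterexampleTeam⊨Φ (fo α) α∈Φ =
    fo-downward-closed {α = α} counterexampleTeam⊆T (T⊨Φ (fo α) α∈Φ)
  counterexampleTeam⊨Φ (∼ δ) ∼δ∈Φ =
    counterexample⇒∼ {δ = δ} (counterexampleTeam-counterexample (δ , ∼δ∈Φ))

  counterexampleTeam-CardLeq : CardLeq 𝒜 counterexampleTeam Φ
  counterexampleTeam-CardLeq = image-CardLeq {Φ = Φ} {𝒜 = 𝒜} chosenAssignment

corollary59 : LEM → (τ : Vocabulary) (Φ : FormulaSet τ) → Satisfiable Φ →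
    Σ (Structure τ) λ 𝒜 → Σ (Team 𝒜) λ T → (𝒜 , T ⊨ Φ) × CardLeq 𝒜 T Φ
corollary59 lem τ Φ (𝒜 , T , T⊨Φ) =
  𝒜 , counterexampleTeam , counterexampleTeam⊨Φ , counterexampleTeam-CardLeq
  where open CounterexampleTeam lem {Φ = Φ} {T = T} T⊨Φ
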